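{- Let $\ell$ be an odd positive integer, $k$ a positive integer, and $m=2^k\ell$. Let $N$ be the smallest nonnegative integer such that the sequence $\{t_n\bmod m\}_{n\ge N}$ is periodic (i.e. there is $d\ge1$ with $t_{n+d}\equiv t_n\pmod m$ for all $n\ge N$). Then $N=4k-2$, and $\ell$ is the smallest period of $\{t_n\bmod m\}_{n\ge N}$.
   Context: $t_n$ is the number of involutions of $[n]$ (permutations $\pi$ with $\pi^2=1$), with $t_0=1$. -}

module Defs where

open import Data.Nat using (ℕ; zero; suc)
open import Data.Fin using (Fin; _≟_)
open import Data.Fin.Properties using (all?)
open import Data.Vec using (Vec; []; _∷_; lookup)
open import Data.List using (List; []; _∷_; map; concatMap; filter; length; allFin)
open import Data.Integer using (ℤ; +_; _-_)
open import Data.Integer.Divisibility using (_∣_)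
open import Relation.Binary.PropositionalEquality using (_≡_)
open import Relation.Nullary using (Dec)

-- All functions from Fin k to Fin n, represented as vectors (each exactly once).
allVecs : (n k : ℕ) → List (Vec (Fin n) k)
allVecs n zero = [] ∷ []
allVecs n (suc k) = concatMap (λ v → map (_∷ v) (allFin n)) (allVecs n k)

-- A map f : [n] → [n] is an involution iff f ∘ f = id
-- (such a map is automatically a permutation with π² = 1).
IsInvolution : {n : ℕ} → Vec (Fin n) n → Set
IsInvolution {n} f = ∀ (i : Fin n) → lookup f (lookup f i) ≡ i

isInvolution? : {n : ℕ} (f : Vec (Fin n) n) → Dec (IsInvolution f)
isInvolution? f = all? (λ i → lookup f (lookup f i) ≟ i)

t : ℕ → ℕ
t n = length (filter isInvolution? (allVecs n n))

_≡_[mod_] : ℕ → ℕ → ℕ → Set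
a ≡ b [mod m ] = (+ m) ∣ ((+ a) - (+ b))

module Submission where

open import Defs
open import Level using (0ℓ)
open import Data.Nat
open import Data.Nat.Properties
open import Data.Nat.Divisibility
open import Data.Nat.DivMod using (_/_; m*[n/m]≡n; m/n*n≡m)
open import Data.Nat.GCD using (gcd; gcd[m,n]∣m; gcd[m,n]∣n; gcd[m,n]≢0)
open import Data.Nat.Coprimality as Coprimality using (Coprime; coprime-divisor; coprime-/gcd)
open import Data.Nat.Combinatorics using (_C_; k>n⇒nCk≡0; nC1≡n; nCk+nC[k+1]≡[n+1]C[k+1])
open import Data.Nat.Tactic.RingSolver using (solve-∀)
open import Algebra.Properties.Semiring.Sum +-*-semiring
  using (sum; sum-syntax; ∑-distrib-+; *-distribˡ-sum; sum-cong-≗; sum-replicate-zero)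
open import Data.Fin as Fin using (Fin; toℕ)
open import Data.Product using (_×_; ∃-syntax; _,_; proj₁; proj₂)
open import Data.Sum using (_⊎_; inj₁; inj₂)
open import Function using (_∘_)
open import Relation.Binary.Bundles using (Setoid)
open import Relation.Binary.Structures using (IsEquivalence)
open import Relation.Binary.PropositionalEquality
open import Relation.Nullary using (¬_; contradiction)

-- Sorting the involutions of [n + 2] by the partner of 0 gives the recurrence
-- t (n + 2) = t (n + 1) + (n + 1) t n.  Modulo an odd ℓ it yields t (n + ℓ) ≡ t n · t ℓ,
-- and t ℓ = Σⱼ C(ℓ, 2j) (2j − 1)!! ≡ 1, so ℓ is a period from the start.  Modulo 2^k,
-- t (4q) and t (4q + 1) have 2-adic valuation exactly q while 2^(q+1) divides t (4q + 2)
-- and t (4q + 3), hence all later terms: t vanishes modulo 2^k from 4k − 2 on, but not at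
-- 4k − 3, which periodicity from any earlier point would force.  Conversely, a period d
-- modulo ℓ gives d · t n ≡ 0 for large n (compare the recurrence at n and n + d), so the
-- odd number ℓ / gcd ℓ d divides all late terms; since ℓ / gcd ℓ d is itself a period of t
-- modulo ℓ / gcd ℓ d and t 0 = 1, it equals 1, that is ℓ ∣ d.

-- Counting involutions

module Involutions where

  open import Data.Fin using (Fin; zero; suc; punchIn; punchOut)
  import Data.Fin.Properties as Finₚ
  open Finₚ
    using (injective⇒≤; punchOut-cong; punchIn-punchOut; punchOut-punchIn; punchInᵢ≢i)
    renaming (_≟_ to _≟ᶠ_)
  open import Data.Vec using (Vec; []; _∷_; lookup; tabulate)
  open import Data.Vec.Properties using (∷-injectiveˡ; ∷-injectiveʳ; lookup∘tabulate; tabulate∘lookup; tabulate-cong)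
  open import Data.List
    using (List; []; _∷_; length; map; _++_; concatMap; filter; allFin; cartesianProductWith; cartesianProduct)
  import Data.List as List
  open import Data.List.Properties using (length-++; length-map; length-tabulate)
  open import Data.List.Membership.Propositional using (_∈_)
  open import Data.List.Membership.Propositional.Properties
    using (∈-lookup; ∈-map⁺; ∈-map⁻; ∈-allFin; ∈-filter⁺; ∈-filter⁻; ∈-++⁺ˡ; ∈-++⁺ʳ; ∈-++⁻;
           ∈-cartesianProductWith⁺; ∈-cartesianProduct⁺; ∈-cartesianProduct⁻)
  open import Data.List.Relation.Unary.Any using (here; index)
  open import Data.List.Relation.Unary.Any.Properties using (lookup-index)
  import Data.List.Relation.Unary.All as All
  open import Data.List.Relation.Unary.AllPairs using ([]; _∷_)
  open import Data.List.Relation.Unary.Unique.Propositional using (Unique)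
  import Data.List.Relation.Unary.Unique.Propositional.Properties as Unique
  open import Data.Sum.Properties using (inj₁-injective; inj₂-injective)
  open import Data.List.Relation.Binary.Disjoint.Propositional using (Disjoint)
  open import Data.Empty using (⊥-elim)
  open import Relation.Nullary using (yes; no)
  open import Function using (case_of_)

  private
    variable
      A B C : Set

  Unique⇒lookup-injective : {xs : List A} → Unique xs →
                            ∀ i j → List.lookup xs i ≡ List.lookup xs j → i ≡ j
  Unique⇒lookup-injective (_ ∷ _) zero zero _ = refl
  Unique⇒lookup-injective (x∉ ∷ _) zero (suc j) eq = ⊥-elim (All.lookup x∉ (∈-lookup j) eq)
  Unique⇒lookup-injective (x∉ ∷ _) (suc i) zero eq = ⊥-elim (All.lookup x∉ (∈-lookup i) (sym eq))
  Unique⇒lookup-injective (_ ∷ u) (suc i) (suc j) eq = cong suc (Unique⇒lookup-injective u i j eq)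

  injection⇒length≤ : {xs : List A} {ys : List B} → Unique xs → (f : A → B) →
                      (∀ {x} → x ∈ xs → f x ∈ ys) →
                      (∀ {x y} → x ∈ xs → y ∈ xs → f x ≡ f y → x ≡ y) →
                      length xs ≤ length ys
  injection⇒length≤ {xs = xs} {ys = ys} u f f∈ f-inj = injective⇒≤ {f = position} position-injective
    where
    position : Fin (length xs) → Fin (length ys)
    position i = index (f∈ (∈-lookup i))
    position-injective : ∀ {i j} → position i ≡ position j → i ≡ j
    position-injective {i} {j} eq = Unique⇒lookup-injective u i j (f-inj (∈-lookup i) (∈-lookup j) (begin
      f (List.lookup xs i)          ≡⟨ lookup-index (f∈ (∈-lookup i)) ⟩
      List.lookup ys (position i)   ≡⟨ cong (List.lookup ys) eq ⟩
      List.lookup ys (position j)   ≡⟨ lookup-index (f∈ (∈-lookup j)) ⟨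
      f (List.lookup xs j)          ∎))
      where open ≡-Reasoning

  bijection⇒length≡ : {xs : List A} {ys : List B} → Unique xs → Unique ys →
                      (f : A → B) (g : B → A) →
                      (∀ {x} → x ∈ xs → f x ∈ ys) → (∀ {y} → y ∈ ys → g y ∈ xs) →
                      (∀ {x} → x ∈ xs → g (f x) ≡ x) → (∀ {y} → y ∈ ys → f (g y) ≡ y) →
                      length xs ≡ length ys
  bijection⇒length≡ uxs uys f g f∈ g∈ gf fg = ≤-antisym
    (injection⇒length≤ uxs f f∈ (λ x∈ y∈ eq → trans (sym (gf x∈)) (trans (cong g eq) (gf y∈))))
    (injection⇒length≤ uys g g∈ (λ x∈ y∈ eq → trans (sym (fg x∈)) (trans (cong f eq) (fg y∈))))

  module _ (f : A → B → C) where

    concatMap≡cartesianProductWith : ∀ xs ys → concatMap (λ x → map (f x) ys) xs ≡ cartesianProductWith f xs ys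
    concatMap≡cartesianProductWith [] ys = refl
    concatMap≡cartesianProductWith (x ∷ xs) ys = cong (map (f x) ys ++_) (concatMap≡cartesianProductWith xs ys)

    length-cartesianProductWith : ∀ xs ys → length (cartesianProductWith f xs ys) ≡ length xs * length ys
    length-cartesianProductWith [] ys = refl
    length-cartesianProductWith (x ∷ xs) ys = begin
      length (map (f x) ys ++ cartesianProductWith f xs ys)          ≡⟨ length-++ (map (f x) ys) ⟩
      length (map (f x) ys) + length (cartesianProductWith f xs ys)  ≡⟨ cong₂ _+_ (length-map (f x) ys) (length-cartesianProductWith xs ys) ⟩
      length ys + length xs * length ys                              ∎
      where open ≡-Reasoning

  allVecs≡cartesianProductWith : ∀ n k → allVecs n (suc k) ≡ cartesianProductWith (λ v x → x ∷ v) (allVecs n k) (allFin n)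
  allVecs≡cartesianProductWith n k = concatMap≡cartesianProductWith (λ v x → x ∷ v) (allVecs n k) (allFin n)

  ∈-allVecs : ∀ {n k} (v : Vec (Fin n) k) → v ∈ allVecs n k
  ∈-allVecs [] = here refl
  ∈-allVecs {n} {suc k} (x ∷ v) = subst (x ∷ v ∈_) (sym (allVecs≡cartesianProductWith n k))
    (∈-cartesianProductWith⁺ (λ v x → x ∷ v) (∈-allVecs v) (∈-allFin x))

  allVecs-unique : ∀ n k → Unique (allVecs n k)
  allVecs-unique n zero = All.[] ∷ []
  allVecs-unique n (suc k) = subst Unique (sym (allVecs≡cartesianProductWith n k))
    (Unique.cartesianProductWith⁺ (λ v x → x ∷ v) (λ eq → ∷-injectiveʳ eq , ∷-injectiveˡ eq)
      (allVecs-unique n k) (Unique.allFin⁺ n))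

  Endo : ℕ → Set
  Endo n = Vec (Fin n) n

  involutions : ∀ n → List (Endo n)
  involutions n = filter isInvolution? (allVecs n n)

  involutions-unique : ∀ n → Unique (involutions n)
  involutions-unique n = Unique.filter⁺ isInvolution? (allVecs-unique n n)

  ∈-involutions⁺ : ∀ {n} {v : Endo n} → IsInvolution v → v ∈ involutions n
  ∈-involutions⁺ {v = v} = ∈-filter⁺ isInvolution? (∈-allVecs v)

  ∈-involutions⁻ : ∀ {n} {v : Endo n} → v ∈ involutions n → IsInvolution v
  ∈-involutions⁻ {n} v∈ = proj₂ (∈-filter⁻ isInvolution? {xs = allVecs n n} v∈)

  -- An involution of Fin (2 + n) either fixes 0 or exchanges 0 with some suc j; removing
  -- these points, renumbered via suc and suc ∘ punchIn j respectively, leaves an involution.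
  Split : ℕ → Set
  Split n = Endo (suc n) ⊎ (Fin (suc n) × Endo n)

  module _ {n : ℕ} where

    unsuc : Fin (suc (suc n)) → Fin (suc n)
    unsuc zero = zero
    unsuc (suc c) = c

    -- The default a is returned only on arguments that do not occur for involutions.
    shrink : Fin (suc n) → Fin n → Fin (suc (suc n)) → Fin n
    shrink j a zero = a
    shrink j a (suc c) with j ≟ᶠ c
    ... | yes _ = a
    ... | no j≢c = punchOut j≢c

    expand : Fin (suc n) → Endo n → Fin (suc n) → Fin (suc (suc n))
    expand j u i with j ≟ᶠ i
    ... | yes _ = zero
    ... | no j≢i = suc (punchIn j (lookup u (punchOut j≢i)))

    split : Endo (suc (suc n)) → Split n
    split (zero ∷ w) = inj₁ (tabulate (unsuc ∘ lookup w))
    split (suc j ∷ w) = inj₂ (j , tabulate (λ a → shrink j a (lookup w (punchIn j a))))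

    unsplit : Split n → Endo (suc (suc n))
    unsplit (inj₁ u) = zero ∷ tabulate (suc ∘ lookup u)
    unsplit (inj₂ (j , u)) = suc j ∷ tabulate (expand j u)

    shrink-≢ : ∀ j a c (j≢c : j ≢ c) → shrink j a (suc c) ≡ punchOut j≢c
    shrink-≢ j a c j≢c with j ≟ᶠ c
    ... | yes j≡c = ⊥-elim (j≢c j≡c)
    ... | no _ = punchOut-cong j refl

    expand-≡ : ∀ j u → expand j u j ≡ zero
    expand-≡ j u with j ≟ᶠ j
    ... | yes _ = refl
    ... | no j≢j = ⊥-elim (j≢j refl)

    expand-≢ : ∀ j u i (j≢i : j ≢ i) → expand j u i ≡ suc (punchIn j (lookup u (punchOut j≢i)))
    expand-≢ j u i j≢i with j ≟ᶠ i
    ... | yes j≡i = ⊥-elim (j≢i j≡i)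
    ... | no _ = cong (λ z → suc (punchIn j (lookup u z))) (punchOut-cong j refl)

    punchIn-≢ : ∀ (j : Fin (suc n)) a → j ≢ punchIn j a
    punchIn-≢ j a = punchInᵢ≢i j a ∘ sym

    punchOut-punchIn-≢ : ∀ (j : Fin (suc n)) a → punchOut (punchIn-≢ j a) ≡ a
    punchOut-punchIn-≢ j a = punchOut-punchIn j

    expand-punchIn : ∀ j u a → expand j u (punchIn j a) ≡ suc (punchIn j (lookup u a))
    expand-punchIn j u a = trans (expand-≢ j u _ (punchIn-≢ j a))
                                  (cong (λ z → suc (punchIn j (lookup u z))) (punchOut-punchIn-≢ j a))

    split∘unsplit : ∀ y → split (unsplit y) ≡ y
    split∘unsplit (inj₁ u) = cong inj₁ (trans (tabulate-cong λ i → cong unsuc (lookup∘tabulate (suc ∘ lookup u) i)) (tabulate∘lookup u))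
    split∘unsplit (inj₂ (j , u)) = cong (λ z → inj₂ (j , z)) (trans (tabulate-cong shrink-expand) (tabulate∘lookup u))
      where
      shrink-expand : ∀ a → shrink j a (lookup (tabulate (expand j u)) (punchIn j a)) ≡ lookup u a
      shrink-expand a = begin
        shrink j a (lookup (tabulate (expand j u)) (punchIn j a))  ≡⟨ cong (shrink j a) (lookup∘tabulate (expand j u) (punchIn j a)) ⟩
        shrink j a (expand j u (punchIn j a))                      ≡⟨ cong (shrink j a) (expand-punchIn j u a) ⟩
        shrink j a (suc (punchIn j (lookup u a)))                  ≡⟨ shrink-≢ j a _ (punchIn-≢ j (lookup u a)) ⟩
        punchOut (punchIn-≢ j (lookup u a))                        ≡⟨ punchOut-punchIn-≢ j (lookup u a) ⟩
        lookup u a                                                 ∎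
        where open ≡-Reasoning

    unsplit-fixing-involution : ∀ u → IsInvolution u → IsInvolution (unsplit (inj₁ u))
    unsplit-fixing-involution u inv zero = refl
    unsplit-fixing-involution u inv (suc i) = begin
      lookup v (lookup (tabulate (suc ∘ lookup u)) i)  ≡⟨ cong (lookup v) (lookup∘tabulate (suc ∘ lookup u) i) ⟩
      lookup (tabulate (suc ∘ lookup u)) (lookup u i)  ≡⟨ lookup∘tabulate (suc ∘ lookup u) (lookup u i) ⟩
      suc (lookup u (lookup u i))                      ≡⟨ cong suc (inv i) ⟩
      suc i                                            ∎
      where
      open ≡-Reasoning
      v = unsplit (inj₁ u)

    unsplit-swapping-involution : ∀ j u → IsInvolution u → IsInvolution (unsplit (inj₂ (j , u)))
    unsplit-swapping-involution j u inv zero = trans (lookup∘tabulate (expand j u) j) (expand-≡ j u)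
    unsplit-swapping-involution j u inv (suc i) with j ≟ᶠ i
    ... | yes refl = cong (lookup v) (trans (lookup∘tabulate (expand j u) j) (expand-≡ j u))
      where v = unsplit (inj₂ (j , u))
    ... | no j≢i = begin
      lookup v (lookup W i)         ≡⟨ cong (lookup v) (trans (lookup∘tabulate (expand j u) i) (expand-≢ j u i j≢i)) ⟩
      lookup W (punchIn j b)        ≡⟨ lookup∘tabulate (expand j u) (punchIn j b) ⟩
      expand j u (punchIn j b)      ≡⟨ expand-punchIn j u b ⟩
      suc (punchIn j (lookup u b))  ≡⟨ cong (suc ∘ punchIn j) (inv a) ⟩
      suc (punchIn j a)             ≡⟨ cong suc (punchIn-punchOut j≢i) ⟩
      suc i                         ∎
      where
      open ≡-Reasoning
      v = unsplit (inj₂ (j , u))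
      W = tabulate (expand j u)
      a = punchOut j≢i
      b = lookup u a

    module FixingZero (w : Vec (Fin (suc (suc n))) (suc n)) (inv : IsInvolution {suc (suc n)} (zero ∷ w)) where

      lookup-suc : ∀ i → lookup w i ≡ suc (unsuc (lookup w i))
      lookup-suc i with lookup w i in eq
      ... | zero = ⊥-elim (Finₚ.0≢1+n (trans (sym (cong (lookup (zero ∷ w)) eq)) (inv (suc i))))
      ... | suc c = refl

      restriction : Endo (suc n)
      restriction = tabulate (unsuc ∘ lookup w)

      restriction-involution : IsInvolution restriction
      restriction-involution i = begin
        lookup restriction (lookup restriction i)             ≡⟨ cong (lookup restriction) (lookup∘tabulate (unsuc ∘ lookup w) i) ⟩
        lookup restriction (unsuc (lookup w i))               ≡⟨ lookup∘tabulate (unsuc ∘ lookup w) (unsuc (lookup w i)) ⟩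
        unsuc (lookup w (unsuc (lookup w i)))                 ≡⟨⟩
        unsuc (lookup (zero ∷ w) (suc (unsuc (lookup w i))))  ≡⟨ cong (unsuc ∘ lookup (zero ∷ w)) (lookup-suc i) ⟨
        unsuc (lookup (zero ∷ w) (lookup w i))                ≡⟨ cong unsuc (inv (suc i)) ⟩
        i                                                     ∎
        where open ≡-Reasoning

      unsplit∘split : unsplit (split (zero ∷ w)) ≡ zero ∷ w
      unsplit∘split = cong (zero ∷_) (trans
        (tabulate-cong (λ i → trans (cong suc (lookup∘tabulate (unsuc ∘ lookup w) i)) (sym (lookup-suc i))))
        (tabulate∘lookup w))

    module SwappingZero (j : Fin (suc n)) (w : Vec (Fin (suc (suc n))) (suc n))
                        (inv : IsInvolution {suc (suc n)} (suc j ∷ w)) where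

      v : Endo (suc (suc n))
      v = suc j ∷ w

      lookup-j : lookup w j ≡ zero
      lookup-j = inv zero

      lookup-≢ : ∀ i → j ≢ i → ∃[ c ] lookup w i ≡ suc c × j ≢ c
      lookup-≢ i j≢i with lookup w i in eq
      ... | zero = ⊥-elim (j≢i (Finₚ.suc-injective (trans (sym (cong (lookup v) eq)) (inv (suc i)))))
      ... | suc c = c , refl , λ { refl → Finₚ.0≢1+n (trans (sym lookup-j) (trans (sym (cong (lookup v) eq)) (inv (suc i)))) }

      restrict : Fin n → Fin n
      restrict a = shrink j a (lookup w (punchIn j a))

      restriction : Endo n
      restriction = tabulate restrict

      lookup-restriction : ∀ a → let (c , _ , j≢c) = lookup-≢ (punchIn j a) (punchIn-≢ j a)
                                 in lookup restriction a ≡ punchOut j≢c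
      lookup-restriction a with lookup-≢ (punchIn j a) (punchIn-≢ j a)
      ... | c , w[a]≡c , j≢c = trans (lookup∘tabulate restrict a) (trans (cong (shrink j a) w[a]≡c) (shrink-≢ j a c j≢c))

      restriction-involution : IsInvolution restriction
      restriction-involution a with lookup-≢ (punchIn j a) (punchIn-≢ j a) | lookup-restriction a
      ... | c , w[a]≡c , j≢c | r[a]≡b = begin
        lookup restriction (lookup restriction a)             ≡⟨ cong (lookup restriction) r[a]≡b ⟩
        lookup restriction b                                  ≡⟨ lookup∘tabulate restrict b ⟩
        shrink j b (lookup w (punchIn j b))                   ≡⟨ cong (λ z → shrink j b (lookup w z)) (punchIn-punchOut j≢c) ⟩
        shrink j b (lookup v (suc c))                         ≡⟨ cong (λ z → shrink j b (lookup v z)) w[a]≡c ⟨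
        shrink j b (lookup v (lookup v (suc (punchIn j a))))  ≡⟨ cong (shrink j b) (inv (suc (punchIn j a))) ⟩
        shrink j b (suc (punchIn j a))                        ≡⟨ shrink-≢ j b _ (punchIn-≢ j a) ⟩
        punchOut (punchIn-≢ j a)                              ≡⟨ punchOut-punchIn-≢ j a ⟩
        a                                                     ∎
        where
        open ≡-Reasoning
        b = punchOut j≢c

      expand-restriction-≢ : ∀ i → j ≢ i → expand j restriction i ≡ lookup w i
      expand-restriction-≢ i j≢i with lookup-≢ i j≢i
      ... | c , w[i]≡c , j≢c = begin
        expand j restriction i                                 ≡⟨ expand-≢ j restriction i j≢i ⟩
        suc (punchIn j (lookup restriction a))                 ≡⟨ cong (suc ∘ punchIn j) (lookup∘tabulate restrict a) ⟩
        suc (punchIn j (shrink j a (lookup w (punchIn j a))))  ≡⟨ cong (λ z → suc (punchIn j (shrink j a (lookup w z)))) (punchIn-punchOut j≢i) ⟩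
        suc (punchIn j (shrink j a (lookup w i)))              ≡⟨ cong (suc ∘ punchIn j ∘ shrink j a) w[i]≡c ⟩
        suc (punchIn j (shrink j a (suc c)))                   ≡⟨ cong (suc ∘ punchIn j) (shrink-≢ j a c j≢c) ⟩
        suc (punchIn j (punchOut j≢c))                         ≡⟨ cong suc (punchIn-punchOut j≢c) ⟩
        suc c                                                  ≡⟨ w[i]≡c ⟨
        lookup w i                                             ∎
        where
        open ≡-Reasoning
        a = punchOut j≢i

      expand-restriction : ∀ i → expand j restriction i ≡ lookup w i
      expand-restriction i = case j ≟ᶠ i of λ where
        (yes refl) → trans (expand-≡ j restriction) (sym lookup-j)
        (no j≢i) → expand-restriction-≢ i j≢i

      unsplit∘split : unsplit (split v) ≡ v
      unsplit∘split = cong (suc j ∷_) (trans (tabulate-cong expand-restriction) (tabulate∘lookup w))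

  splitInvolutions : ∀ n → List (Split n)
  splitInvolutions n = map inj₁ (involutions (suc n)) ++ map inj₂ (cartesianProduct (allFin (suc n)) (involutions n))

  splitInvolutions-unique : ∀ n → Unique (splitInvolutions n)
  splitInvolutions-unique n = Unique.++⁺
    (Unique.map⁺ inj₁-injective (involutions-unique (suc n)))
    (Unique.map⁺ inj₂-injective (Unique.cartesianProduct⁺ (Unique.allFin⁺ (suc n)) (involutions-unique n)))
    disjoint
    where
    disjoint : Disjoint (map inj₁ (involutions (suc n))) (map inj₂ (cartesianProduct (allFin (suc n)) (involutions n)))
    disjoint (z∈₁ , z∈₂) with ∈-map⁻ inj₁ z∈₁ | ∈-map⁻ inj₂ z∈₂
    ... | _ , _ , refl | _ , _ , ()

  length-splitInvolutions : ∀ n → length (splitInvolutions n) ≡ t (suc n) + suc n * t n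
  length-splitInvolutions n = begin
    length (map inj₁ fixing ++ map inj₂ swapping)        ≡⟨ length-++ (map inj₁ fixing) ⟩
    length (map inj₁ fixing) + length (map inj₂ swapping)  ≡⟨ cong₂ _+_ (length-map inj₁ fixing) (length-map inj₂ swapping) ⟩
    t (suc n) + length swapping                            ≡⟨ cong (t (suc n) +_) (length-cartesianProductWith _,_ (allFin (suc n)) (involutions n)) ⟩
    t (suc n) + length (allFin (suc n)) * t n              ≡⟨ cong (λ m → t (suc n) + m * t n) (length-tabulate {n = suc n} (λ i → i)) ⟩
    t (suc n) + suc n * t n                                ∎
    where
    open ≡-Reasoning
    fixing = involutions (suc n)
    swapping = cartesianProduct (allFin (suc n)) (involutions n)

  module _ {n : ℕ} where

    split-∈ : ∀ {v} → v ∈ involutions (suc (suc n)) → split v ∈ splitInvolutions n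
    split-∈ {zero ∷ w} v∈ = ∈-++⁺ˡ (∈-map⁺ inj₁ (∈-involutions⁺ (FixingZero.restriction-involution w (∈-involutions⁻ v∈))))
    split-∈ {suc j ∷ w} v∈ = ∈-++⁺ʳ _ (∈-map⁺ inj₂ (∈-cartesianProduct⁺ (∈-allFin j)
      (∈-involutions⁺ (SwappingZero.restriction-involution j w (∈-involutions⁻ v∈)))))

    unsplit-∈ : ∀ {y} → y ∈ splitInvolutions n → unsplit y ∈ involutions (suc (suc n))
    unsplit-∈ y∈ with ∈-++⁻ (map inj₁ (involutions (suc n))) y∈
    ... | inj₁ y∈₁ with ∈-map⁻ inj₁ y∈₁
    ...   | u , u∈ , refl = ∈-involutions⁺ (unsplit-fixing-involution u (∈-involutions⁻ u∈))
    unsplit-∈ y∈ | inj₂ y∈₂ with ∈-map⁻ inj₂ y∈₂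
    ...   | (j , u) , ju∈ , refl =
      ∈-involutions⁺ (unsplit-swapping-involution j u (∈-involutions⁻ (proj₂ (∈-cartesianProduct⁻ (allFin (suc n)) _ ju∈))))

    unsplit∘split : ∀ {v} → v ∈ involutions (suc (suc n)) → unsplit (split v) ≡ v
    unsplit∘split {zero ∷ w} v∈ = FixingZero.unsplit∘split w (∈-involutions⁻ v∈)
    unsplit∘split {suc j ∷ w} v∈ = SwappingZero.unsplit∘split j w (∈-involutions⁻ v∈)

  t-recurrence : ∀ n → t (suc (suc n)) ≡ t (suc n) + suc n * t n
  t-recurrence n = trans
    (bijection⇒length≡ (involutions-unique (suc (suc n))) (splitInvolutions-unique n) split unsplit
      split-∈ unsplit-∈ unsplit∘split (λ {y} _ → split∘unsplit y))
    (length-splitInvolutions n)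

open Involutions using (t-recurrence)

odd⇒≡1+2* : ∀ {n} → ¬ 2 ∣ n → ∃[ h ] n ≡ suc (2 * h)
odd⇒≡1+2* {0} ¬2∣0 = contradiction (2 ∣0) ¬2∣0
odd⇒≡1+2* {1} _ = 0 , refl
odd⇒≡1+2* {suc (suc n)} ¬2∣2+n with odd⇒≡1+2* (¬2∣2+n ∘ ∣m∣n⇒∣m+n (∣-refl {2}))
... | h , refl = suc h , cong (suc ∘ suc) (sym (+-suc h (h + 0)))

¬2∣1+2* : ∀ a → ¬ 2 ∣ suc (2 * a)
¬2∣1+2* a 2∣1+2a = contradiction (∣1⇒≡1 (∣m+n∣m⇒∣n (subst (2 ∣_) (+-comm 1 (2 * a)) 2∣1+2a) (m∣m*n a))) λ ()

odd⇒coprime-2 : ∀ {n} → ¬ 2 ∣ n → Coprime n 2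
odd⇒coprime-2 ¬2∣n {0} (_ , 0∣2) = contradiction (0∣⇒≡0 0∣2) λ ()
odd⇒coprime-2 ¬2∣n {1} _ = refl
odd⇒coprime-2 ¬2∣n {2} (2∣n , _) = contradiction 2∣n ¬2∣n
odd⇒coprime-2 ¬2∣n {suc (suc (suc d))} (_ , d∣2) = contradiction (∣⇒≤ d∣2) λ { (s≤s (s≤s ())) }

coprime-^ : ∀ {m n} → Coprime m n → ∀ k → Coprime m (n ^ k)
coprime-^ m⊥n zero (d∣m , d∣1) = ∣1⇒≡1 d∣1
coprime-^ m⊥n (suc k) (d∣m , d∣n*n^k) = coprime-^ m⊥n k
  (d∣m , coprime-divisor (λ (e∣d , e∣n) → m⊥n (∣-trans e∣d d∣m , e∣n)) d∣n*n^k)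

coprime⇒m*n∣o : ∀ {m n o} → Coprime m n → m ∣ o → n ∣ o → m * n ∣ o
coprime⇒m*n∣o {m} {n} m⊥n (divides-refl q) n∣q*m =
  subst (m * n ∣_) (*-comm m q) (*-monoʳ-∣ m (coprime-divisor (Coprimality.sym m⊥n) (subst (n ∣_) (*-comm q m) n∣q*m)))

∣-*⇒/gcd∣ : ∀ {m n o} .{{_ : NonZero (gcd m n)}} → m ∣ n * o → m / gcd m n ∣ o
∣-*⇒/gcd∣ {m} {n} {o} m∣n*o = coprime-divisor (coprime-/gcd m n) (*-cancelˡ-∣ g (subst₂ _∣_
  (sym (m*[n/m]≡n (gcd[m,n]∣m m n)))
  (trans (cong (_* o) (sym (m*[n/m]≡n (gcd[m,n]∣n m n)))) (*-assoc g (n / g) o))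
  m∣n*o))
  where g = gcd m n

module _ where

  open import Data.Integer as ℤ using (+_)
  import Data.Integer.Properties as ℤₚ
  import Data.Integer.Divisibility.Signed as ℤ∣
  import Data.Integer.Tactic.RingSolver as ℤ-Solver

  -- Equivalent to _≡_[mod_], but a record, so that a and b can be inferred from a proof.
  record Congruent (m a b : ℕ) : Set where
    constructor congruent
    field
      divides-difference : + m ℤ∣.∣ (+ a ℤ.- + b)

  module _ {m : ℕ} where

    congruent-refl : ∀ {a} → Congruent m a a
    congruent-refl {a} = congruent (ℤ∣.divides (+ 0) (x-x≡0*m (+ a) (+ m)))
      where x-x≡0*m : ∀ x m → x ℤ.- x ≡ + 0 ℤ.* m
            x-x≡0*m = ℤ-Solver.solve-∀

    congruent-sym : ∀ {a b} → Congruent m a b → Congruent m b a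
    congruent-sym {a} {b} (congruent m∣a-b) = congruent (subst (+ m ℤ∣.∣_) (-[x-y]≡y-x (+ a) (+ b)) (ℤ∣.∣m⇒∣-m m∣a-b))
      where -[x-y]≡y-x : ∀ x y → ℤ.- (x ℤ.- y) ≡ y ℤ.- x
            -[x-y]≡y-x = ℤ-Solver.solve-∀

    congruent-trans : ∀ {a b c} → Congruent m a b → Congruent m b c → Congruent m a c
    congruent-trans {a} {b} {c} (congruent m∣a-b) (congruent m∣b-c) =
      congruent (subst (+ m ℤ∣.∣_) (telescope (+ a) (+ b) (+ c)) (ℤ∣.∣m∣n⇒∣m+n m∣a-b m∣b-c))
      where telescope : ∀ x y z → (x ℤ.- y) ℤ.+ (y ℤ.- z) ≡ x ℤ.- z
            telescope = ℤ-Solver.solve-∀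

    ≡⇒congruent : ∀ {a b} → a ≡ b → Congruent m a b
    ≡⇒congruent refl = congruent-refl

    congruent-isEquivalence : IsEquivalence (Congruent m)
    congruent-isEquivalence = record { refl = congruent-refl ; sym = congruent-sym ; trans = congruent-trans }

    +-congruent : ∀ {a b c d} → Congruent m a b → Congruent m c d → Congruent m (a + c) (b + d)
    +-congruent {a} {b} {c} {d} (congruent m∣a-b) (congruent m∣c-d) =
      congruent (subst (+ m ℤ∣.∣_) (interchange (+ a) (+ b) (+ c) (+ d)) (ℤ∣.∣m∣n⇒∣m+n m∣a-b m∣c-d))
      where interchange : ∀ x y z w → (x ℤ.- y) ℤ.+ (z ℤ.- w) ≡ (x ℤ.+ z) ℤ.- (y ℤ.+ w)
            interchange = ℤ-Solver.solve-∀

    *-congruent : ∀ {a b c d} → Congruent m a b → Congruent m c d → Congruent m (a * c) (b * d)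
    *-congruent {a} {b} {c} {d} (congruent m∣a-b) (congruent m∣c-d) = congruent (subst (+ m ℤ∣.∣_)
      (trans (split (+ a) (+ b) (+ c) (+ d)) (sym (cong₂ ℤ._-_ (ℤₚ.pos-* a c) (ℤₚ.pos-* b d))))
      (ℤ∣.∣m∣n⇒∣m+n (ℤ∣.∣m⇒∣m*n (+ c) m∣a-b) (ℤ∣.∣n⇒∣m*n (+ b) m∣c-d)))
      where split : ∀ x y z w → (x ℤ.- y) ℤ.* z ℤ.+ y ℤ.* (z ℤ.- w) ≡ x ℤ.* z ℤ.- y ℤ.* w
            split = ℤ-Solver.solve-∀

    +-cancelˡ-congruent : ∀ a {b c} → Congruent m (a + b) (a + c) → Congruent m b c
    +-cancelˡ-congruent a {b} {c} (congruent m∣a+b-a-c) = congruent (subst (+ m ℤ∣.∣_) (cancel (+ a) (+ b) (+ c)) m∣a+b-a-c)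
      where cancel : ∀ x y z → (x ℤ.+ y) ℤ.- (x ℤ.+ z) ≡ y ℤ.- z
            cancel = ℤ-Solver.solve-∀

    +-*-congruent : ∀ a x → Congruent m (a + m * x) a
    +-*-congruent a x = congruent (ℤ∣.divides (+ x) (trans (cong (λ z → (+ a ℤ.+ z) ℤ.- + a) (ℤₚ.pos-* m x)) (cancel (+ a) (+ m) (+ x))))
      where cancel : ∀ a m x → (a ℤ.+ m ℤ.* x) ℤ.- a ≡ x ℤ.* m
            cancel = ℤ-Solver.solve-∀

    ∣⇒congruent-0 : ∀ {a} → m ∣ a → Congruent m a 0
    ∣⇒congruent-0 {a} m∣a = congruent (ℤ∣.∣ᵤ⇒∣ (subst (λ z → m ∣ ℤ.∣ z ∣) (sym (ℤₚ.+-identityʳ (+ a))) m∣a))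

    congruent-0⇒∣ : ∀ {a} → Congruent m a 0 → m ∣ a
    congruent-0⇒∣ {a} (congruent m∣a-0) = subst (λ z → m ∣ ℤ.∣ z ∣) (ℤₚ.+-identityʳ (+ a)) (ℤ∣.∣⇒∣ᵤ m∣a-0)

    congruent⇒≡[mod] : ∀ {a b} → Congruent m a b → a ≡ b [mod m ]
    congruent⇒≡[mod] (congruent m∣a-b) = ℤ∣.∣⇒∣ᵤ m∣a-b

    ≡[mod]⇒congruent : ∀ {a b} → a ≡ b [mod m ] → Congruent m a b
    ≡[mod]⇒congruent m∣a-b = congruent (ℤ∣.∣ᵤ⇒∣ m∣a-b)

  congruent-setoid : ℕ → Setoid 0ℓ 0ℓ
  congruent-setoid m = record { isEquivalence = congruent-isEquivalence {m} }

  congruent-∣ : ∀ {d m a b} → d ∣ m → Congruent m a b → Congruent d a b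
  congruent-∣ d∣m (congruent m∣a-b) = congruent (ℤ∣.∣-trans (ℤ∣.∣ᵤ⇒∣ d∣m) m∣a-b)

  coprime⇒congruent-* : ∀ {m n a b} → Coprime m n → Congruent m a b → Congruent n a b → Congruent (m * n) a b
  coprime⇒congruent-* m⊥n (congruent m∣a-b) (congruent n∣a-b) =
    congruent (ℤ∣.∣ᵤ⇒∣ (coprime⇒m*n∣o m⊥n (ℤ∣.∣⇒∣ᵤ m∣a-b) (ℤ∣.∣⇒∣ᵤ n∣a-b)))

PeriodicFrom : ℕ → (ℕ → ℕ) → ℕ → ℕ → Set
PeriodicFrom m f N d = ∀ n → N ≤ n → Congruent m (f (n + d)) (f n)

periodicFrom-∣ : ∀ {m′ m f N d} → m′ ∣ m → PeriodicFrom m f N d → PeriodicFrom m′ f N d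
periodicFrom-∣ m′∣m periodic n N≤n = congruent-∣ m′∣m (periodic n N≤n)

periodicFrom-iterate : ∀ {m f N d} → PeriodicFrom m f N d → ∀ j n → N ≤ n → Congruent m (f (n + j * d)) (f n)
periodicFrom-iterate {f = f} periodic zero n N≤n = ≡⇒congruent (cong f (+-identityʳ n))
periodicFrom-iterate {m} {f} {d = d} periodic (suc j) n N≤n = begin
  f (n + (d + j * d))  ≡⟨ cong f (reassociate n d (j * d)) ⟩
  f (n + j * d + d)    ≈⟨ periodic (n + j * d) (≤-trans N≤n (m≤m+n n (j * d))) ⟩
  f (n + j * d)        ≈⟨ periodicFrom-iterate periodic j n N≤n ⟩
  f n                  ∎
  where
  open import Relation.Binary.Reasoning.Setoid (congruent-setoid m)
  reassociate : ∀ n d e → n + (d + e) ≡ n + e + d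
  reassociate = solve-∀

telephone : ℕ → ℕ
telephone 0 = 1
telephone 1 = 1
telephone (suc (suc n)) = telephone (suc n) + suc n * telephone n

t≡telephone : ∀ n → t n ≡ telephone n
t≡telephone 0 = refl
t≡telephone 1 = refl
t≡telephone (suc (suc n)) = trans (t-recurrence n) (cong₂ (λ a b → a + suc n * b) (t≡telephone (suc n)) (t≡telephone n))

telephone[1+m]≡telephone[m] : ∀ m → Congruent m (telephone (suc m)) (telephone m)
telephone[1+m]≡telephone[m] zero = congruent-refl
telephone[1+m]≡telephone[m] (suc m) = +-*-congruent (telephone (suc m)) (telephone m)

telephone[n+m]≡telephone[n]*telephone[m] : ∀ m n → Congruent m (telephone (n + m)) (telephone n * telephone m)
telephone[n+m]≡telephone[n]*telephone[m] m n = proj₁ (consecutive n)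
  where
  open import Relation.Binary.Reasoning.Setoid (congruent-setoid m)
  base : Congruent m (telephone (suc m)) (telephone 1 * telephone m)
  base = congruent-trans (telephone[1+m]≡telephone[m] m) (≡⇒congruent (sym (*-identityˡ (telephone m))))
  consecutive : ∀ n → Congruent m (telephone (n + m)) (telephone n * telephone m)
                    × Congruent m (telephone (suc n + m)) (telephone (suc n) * telephone m)
  consecutive zero = ≡⇒congruent (sym (*-identityˡ (telephone m))) , base
  consecutive (suc n) = let (IH₀ , IH₁) = consecutive n in IH₁ , (begin
    telephone (suc (n + m)) + (suc n + m) * telephone (n + m)
      ≈⟨ +-congruent IH₁ (*-congruent (congruent-refl {a = suc n + m}) IH₀) ⟩
    a + (suc n + m) * b          ≡⟨ distribute a b n m ⟩
    (a + suc n * b) + m * b      ≈⟨ +-*-congruent _ b ⟩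
    a + suc n * b                ≡⟨ factor (telephone (suc n)) (telephone n) (telephone m) n ⟩
    telephone (suc (suc n)) * telephone m ∎)
    where
    a = telephone (suc n) * telephone m
    b = telephone n * telephone m
    distribute : ∀ a b n m → a + (suc n + m) * b ≡ (a + suc n * b) + m * b
    distribute = solve-∀
    factor : ∀ x y z n → x * z + suc n * (y * z) ≡ (x + suc n * y) * z
    factor = solve-∀

-- Telephone numbers modulo an odd number

[1+k]*[1+n]C[1+k]≡[1+n]*nCk : ∀ n k → suc k * (suc n C suc k) ≡ suc n * (n C k)
[1+k]*[1+n]C[1+k]≡[1+n]*nCk zero zero = refl
[1+k]*[1+n]C[1+k]≡[1+n]*nCk zero (suc k) = begin
  suc (suc k) * (1 C suc (suc k))  ≡⟨ cong (suc (suc k) *_) (k>n⇒nCk≡0 (s<s (z<s {suc k}))) ⟩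
  suc (suc k) * 0                  ≡⟨ *-zeroʳ (suc (suc k)) ⟩
  0                                ∎
  where open ≡-Reasoning
[1+k]*[1+n]C[1+k]≡[1+n]*nCk (suc n) zero = begin
  1 * (suc (suc n) C 1)  ≡⟨ *-identityˡ _ ⟩
  suc (suc n) C 1        ≡⟨ nC1≡n (suc (suc n)) ⟩
  suc (suc n)            ≡⟨ *-identityʳ (suc (suc n)) ⟨
  suc (suc n) * 1        ∎
  where open ≡-Reasoning
[1+k]*[1+n]C[1+k]≡[1+n]*nCk (suc n) (suc k) = begin
  (2 + k) * (suc (suc n) C suc (suc k))          ≡⟨ cong ((2 + k) *_) (nCk+nC[k+1]≡[n+1]C[k+1] (suc n) (suc k)) ⟨
  (2 + k) * (suc n C suc k + Z)                  ≡⟨ cong (λ c → (2 + k) * (c + Z)) (nCk+nC[k+1]≡[n+1]C[k+1] n k) ⟨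
  (2 + k) * ((X + Y) + Z)                        ≡⟨ regroup k X Y Z ⟩
  (1 + k) * (X + Y) + (X + Y) + (2 + k) * Z      ≡⟨ cong (λ c → (1 + k) * c + (X + Y) + (2 + k) * Z) (nCk+nC[k+1]≡[n+1]C[k+1] n k) ⟩
  (1 + k) * (suc n C suc k) + (X + Y) + (2 + k) * Z
    ≡⟨ cong₂ (λ u v → u + (X + Y) + v) ([1+k]*[1+n]C[1+k]≡[1+n]*nCk n k) ([1+k]*[1+n]C[1+k]≡[1+n]*nCk n (suc k)) ⟩
  (1 + n) * X + (X + Y) + (1 + n) * Y            ≡⟨ collect n X Y ⟩
  (2 + n) * (X + Y)                              ≡⟨ cong ((2 + n) *_) (nCk+nC[k+1]≡[n+1]C[k+1] n k) ⟩
  (2 + n) * (suc n C suc k)                      ∎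
  where
  open ≡-Reasoning
  X = n C k
  Y = n C suc k
  Z = suc n C suc (suc k)
  regroup : ∀ k X Y Z → (2 + k) * ((X + Y) + Z) ≡ (1 + k) * (X + Y) + (X + Y) + (2 + k) * Z
  regroup = solve-∀
  collect : ∀ n X Y → (1 + n) * X + (X + Y) + (1 + n) * Y ≡ (2 + n) * (X + Y)
  collect = solve-∀

matchings : ℕ → ℕ
matchings zero = 1
matchings (suc j) = suc (2 * j) * matchings j

1+2h∣matchings : ∀ {h j} → h < j → suc (2 * h) ∣ matchings j
1+2h∣matchings {h} {suc j} h<1+j with m<1+n⇒m<n∨m≡n h<1+j
... | inj₁ h<j = ∣n⇒∣m*n (suc (2 * j)) (1+2h∣matchings h<j)
... | inj₂ refl = m∣m*n (matchings h)

odd∣⇒∣matchings : ∀ {g j} → ¬ 2 ∣ g → g ∣ suc j → g ∣ matchings (suc j)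
odd∣⇒∣matchings {g} {j} ¬2∣g g∣1+j with odd⇒≡1+2* ¬2∣g
... | h , refl = 1+2h∣matchings (<-≤-trans (s≤s (m≤m+n h (h + 0))) (∣⇒≤ g∣1+j))

-- The number of involutions of [n] with exactly j two-cycles.
involutionsWithPairs : ℕ → ℕ → ℕ
involutionsWithPairs n j = (n C (2 * j)) * matchings j

involutionsWithPairs-vanish : ∀ {n j} → n < 2 * j → involutionsWithPairs n j ≡ 0
involutionsWithPairs-vanish {j = j} n<2j = cong (_* matchings j) (k>n⇒nCk≡0 n<2j)

involutionsWithPairs-recurrence : ∀ n j →
  involutionsWithPairs (2 + n) (suc j) ≡ suc n * involutionsWithPairs n j + involutionsWithPairs (suc n) (suc j)
involutionsWithPairs-recurrence n j = begin
  ((2 + n) C (2 * suc j)) * M′                            ≡⟨ cong (λ k → ((2 + n) C k) * M′) (*-suc 2 j) ⟩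
  ((2 + n) C (2 + 2 * j)) * M′                            ≡⟨ cong (_* M′) (nCk+nC[k+1]≡[n+1]C[k+1] (suc n) (suc (2 * j))) ⟨
  ((1 + n) C (1 + 2 * j) + (1 + n) C (2 + 2 * j)) * M′    ≡⟨ expand ((1 + n) C (1 + 2 * j)) ((1 + n) C (2 + 2 * j)) j M ⟩
  (1 + 2 * j) * ((1 + n) C (1 + 2 * j)) * M + ((1 + n) C (2 + 2 * j)) * M′
    ≡⟨ cong₂ (λ a k → a * M + ((1 + n) C k) * M′) ([1+k]*[1+n]C[1+k]≡[1+n]*nCk n (2 * j)) (sym (*-suc 2 j)) ⟩
  (1 + n) * (n C (2 * j)) * M + involutionsWithPairs (suc n) (suc j)
    ≡⟨ cong (_+ involutionsWithPairs (suc n) (suc j)) (*-assoc (1 + n) (n C (2 * j)) M) ⟩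
  (1 + n) * involutionsWithPairs n j + involutionsWithPairs (suc n) (suc j)  ∎
  where
  open ≡-Reasoning
  M = matchings j
  M′ = matchings (suc j)
  expand : ∀ a b j M → (a + b) * ((1 + 2 * j) * M) ≡ (1 + 2 * j) * a * M + b * ((1 + 2 * j) * M)
  expand = solve-∀

∣-sum : ∀ {d M} (f : Fin M → ℕ) → (∀ j → d ∣ f j) → d ∣ sum f
∣-sum {M = zero} f d∣f = _ ∣0
∣-sum {M = suc M} f d∣f = ∣m∣n⇒∣m+n (d∣f Fin.zero) (∣-sum (f ∘ Fin.suc) (d∣f ∘ Fin.suc))

∑-involutionsWithPairs-recurrence : ∀ n M →
  ∑[ j < suc M ] involutionsWithPairs (2 + n) (toℕ j)
    ≡ ∑[ j < suc M ] involutionsWithPairs (suc n) (toℕ j) + suc n * ∑[ j < M ] involutionsWithPairs n (toℕ j)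
∑-involutionsWithPairs-recurrence n M = begin
  1 + ∑[ j < M ] involutionsWithPairs (2 + n) (suc (toℕ j))
    ≡⟨ cong suc (sum-cong-≗ {M} (λ j → involutionsWithPairs-recurrence n (toℕ j))) ⟩
  1 + ∑[ j < M ] (suc n * involutionsWithPairs n (toℕ j) + involutionsWithPairs (suc n) (suc (toℕ j)))
    ≡⟨ cong suc (∑-distrib-+ {M} (λ j → suc n * involutionsWithPairs n (toℕ j)) (λ j → involutionsWithPairs (suc n) (suc (toℕ j)))) ⟩
  1 + (∑[ j < M ] (suc n * involutionsWithPairs n (toℕ j)) + B)
    ≡⟨ cong (λ s → 1 + (s + B)) (*-distribˡ-sum {M} (suc n) (λ j → involutionsWithPairs n (toℕ j))) ⟨
  1 + (suc n * A + B)    ≡⟨ swap (suc n * A) B ⟩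
  (1 + B) + suc n * A    ∎
  where
  open ≡-Reasoning
  A = ∑[ j < M ] involutionsWithPairs n (toℕ j)
  B = ∑[ j < M ] involutionsWithPairs (suc n) (suc (toℕ j))
  swap : ∀ x y → 1 + (x + y) ≡ (1 + y) + x
  swap = solve-∀

telephone≡∑ : ∀ n M → n < 2 * M → telephone n ≡ ∑[ j < M ] involutionsWithPairs n (toℕ j)
telephone≡∑ zero (suc M) _ = cong suc (sym (sum-replicate-zero M))
telephone≡∑ (suc zero) (suc M) _ = cong suc (sym (begin
  ∑[ j < M ] involutionsWithPairs 1 (suc (toℕ j))  ≡⟨ sum-cong-≗ {M} (λ j → involutionsWithPairs-vanish {j = suc (toℕ j)} (1<2*[1+j] (toℕ j))) ⟩
  ∑[ j < M ] 0                                     ≡⟨ sum-replicate-zero M ⟩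
  0                                                ∎))
  where
  open ≡-Reasoning
  1<2*[1+j] : ∀ j → 1 < 2 * suc j
  1<2*[1+j] j = subst (1 <_) (sym (*-suc 2 j)) (s<s z<s)
telephone≡∑ (suc (suc n)) (suc M) 2+n<2+2M = begin
  telephone (suc n) + suc n * telephone n
    ≡⟨ cong₂ (λ a b → a + suc n * b) (telephone≡∑ (suc n) (suc M) 1+n<2+2M) (telephone≡∑ n M n<2M) ⟩
  ∑[ j < suc M ] involutionsWithPairs (suc n) (toℕ j) + suc n * ∑[ j < M ] involutionsWithPairs n (toℕ j)
    ≡⟨ ∑-involutionsWithPairs-recurrence n M ⟨
  ∑[ j < suc M ] involutionsWithPairs (2 + n) (toℕ j) ∎
  where
  open ≡-Reasoning
  n<2M : n < 2 * M
  n<2M = s<s⁻¹ (s<s⁻¹ (subst (2 + n <_) (*-suc 2 M) 2+n<2+2M))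
  1+n<2+2M : suc n < 2 * suc M
  1+n<2+2M = subst (suc n <_) (sym (*-suc 2 M)) (s<s (m<n⇒m<1+n n<2M))

-- With g = gcd ℓ (2j + 2), absorption gives ℓ ∣ (2j + 2) C(ℓ, 2j + 2), so ℓ / g divides
-- C(ℓ, 2j + 2); and the odd g divides j + 1, so it is one of the factors of (2j + 1)!!.
odd∣involutionsWithPairs : ∀ {ℓ} j → ¬ 2 ∣ ℓ → ℓ ∣ involutionsWithPairs ℓ (suc j)
odd∣involutionsWithPairs {zero} j ¬2∣0 = contradiction (2 ∣0) ¬2∣0
odd∣involutionsWithPairs {ℓ@(suc ℓ′)} j ¬2∣ℓ =
  subst (_∣ (ℓ C K) * matchings (suc j)) (m/n*n≡m g∣ℓ) (*-pres-∣ ℓ/g∣ℓCK g∣matchings)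
  where
  K = 2 * suc j
  g = gcd ℓ K
  instance
    g≢0 : NonZero g
    g≢0 = ≢-nonZero (gcd[m,n]≢0 ℓ K (inj₂ λ ()))
  g∣ℓ : g ∣ ℓ
  g∣ℓ = gcd[m,n]∣m ℓ K
  ℓ∣K*ℓCK : ℓ ∣ K * (ℓ C K)
  ℓ∣K*ℓCK = subst (λ k → ℓ ∣ k * (ℓ C k)) (sym (*-suc 2 j))
    (subst (ℓ ∣_) (sym ([1+k]*[1+n]C[1+k]≡[1+n]*nCk ℓ′ (suc (2 * j)))) (m∣m*n (ℓ′ C suc (2 * j))))
  ℓ/g∣ℓCK : ℓ / g ∣ ℓ C K
  ℓ/g∣ℓCK = ∣-*⇒/gcd∣ ℓ∣K*ℓCK
  ¬2∣g : ¬ 2 ∣ g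
  ¬2∣g 2∣g = ¬2∣ℓ (∣-trans 2∣g g∣ℓ)
  g∣matchings : g ∣ matchings (suc j)
  g∣matchings = odd∣⇒∣matchings ¬2∣g (coprime-divisor (odd⇒coprime-2 ¬2∣g) (gcd[m,n]∣n ℓ K))

odd⇒telephone[ℓ]≡1 : ∀ {ℓ} → ¬ 2 ∣ ℓ → Congruent ℓ (telephone ℓ) 1
odd⇒telephone[ℓ]≡1 {ℓ} ¬2∣ℓ with ∣-sum {M = ℓ} (λ j → involutionsWithPairs ℓ (suc (toℕ j))) (λ j → odd∣involutionsWithPairs (toℕ j) ¬2∣ℓ)
... | divides q ∑≡q*ℓ = begin
  telephone ℓ                                           ≡⟨ telephone≡∑ ℓ (suc ℓ) (m≤m+n (suc ℓ) (suc ℓ + 0)) ⟩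
  1 + ∑[ j < ℓ ] involutionsWithPairs ℓ (suc (toℕ j))  ≡⟨ cong suc (trans ∑≡q*ℓ (*-comm q ℓ)) ⟩
  1 + ℓ * q                                             ≈⟨ +-*-congruent 1 q ⟩
  1                                                     ∎
  where open import Relation.Binary.Reasoning.Setoid (congruent-setoid ℓ)

odd⇒telephone[n+ℓ]≡telephone[n] : ∀ {ℓ} → ¬ 2 ∣ ℓ → ∀ n → Congruent ℓ (telephone (n + ℓ)) (telephone n)
odd⇒telephone[n+ℓ]≡telephone[n] {ℓ} ¬2∣ℓ n = begin
  telephone (n + ℓ)            ≈⟨ telephone[n+m]≡telephone[n]*telephone[m] ℓ n ⟩
  telephone n * telephone ℓ    ≈⟨ *-congruent (congruent-refl {a = telephone n}) (odd⇒telephone[ℓ]≡1 ¬2∣ℓ) ⟩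
  telephone n * 1              ≡⟨ *-identityʳ (telephone n) ⟩
  telephone n                  ∎
  where open import Relation.Binary.Reasoning.Setoid (congruent-setoid ℓ)

-- Telephone numbers modulo powers of two

TwoAdicValuation : ℕ → ℕ → Set
TwoAdicValuation x q = ∃[ a ] x ≡ 2 ^ q * suc (2 * a)

twoAdicValuation⇒2^∣ : ∀ {x q} → TwoAdicValuation x q → 2 ^ q ∣ x
twoAdicValuation⇒2^∣ {q = q} (a , refl) = m∣m*n (suc (2 * a))

twoAdicValuation⇒2^[1+q]∤ : ∀ {x q} → TwoAdicValuation x q → ¬ 2 ^ suc q ∣ x
twoAdicValuation⇒2^[1+q]∤ {q = q} (a , refl) 2^[1+q]∣x = ¬2∣1+2* a
  (*-cancelˡ-∣ (2 ^ q) {{m^n≢0 2 q}} (subst (_∣ 2 ^ q * suc (2 * a)) (*-comm 2 (2 ^ q)) 2^[1+q]∣x))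

telephone[4+n] : ∀ n → telephone (4 + n) ≡ 2 * (n + 3) * telephone (1 + n) + (n + 1) * (n + 4) * telephone n
telephone[4+n] n = unfold n (telephone n) (telephone (suc n))
  where
  unfold : ∀ n x y → (y + suc n * x + suc (suc n) * y) + suc (suc (suc n)) * (y + suc n * x)
                     ≡ 2 * (n + 3) * y + (n + 1) * (n + 4) * x
  unfold = solve-∀

telephone[5+n] : ∀ n → telephone (5 + n) ≡ (n + 3) * (n + 6) * telephone (1 + n) + 2 * (n + 1) * (n + 4) * telephone n
telephone[5+n] n = unfold n (telephone n) (telephone (suc n))
  where
  unfold : ∀ n x y → ((y + suc n * x + suc (suc n) * y) + suc (suc (suc n)) * (y + suc n * x))
                       + suc (suc (suc (suc n))) * (y + suc n * x + suc (suc n) * y)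
                     ≡ (n + 3) * (n + 6) * y + 2 * (n + 1) * (n + 4) * x
  unfold = solve-∀

telephone-valuation : ∀ q → TwoAdicValuation (telephone (4 * q)) q × TwoAdicValuation (telephone (suc (4 * q))) q
telephone-valuation zero = (0 , refl) , (0 , refl)
telephone-valuation (suc q) with telephone-valuation q
... | (α , T[4q]≡) , (β , T[1+4q]≡) = (α′ , T[4q+4]≡) , (β′ , T[4q+5]≡)
  where
  n = 4 * q
  P = 2 ^ q
  α′ = (2 * q + 1) + (4 * q + 3) * β + (4 * q + 1) * (q + 1) * (1 + 2 * α)
  β′ = (4 * q * q + 9 * q + 4) + (4 * q + 3) * (2 * q + 3) * β + (4 * q + 1) * (2 * q + 2) * (1 + 2 * α)
  factor₄ : ∀ q P α β → 2 * (4 * q + 3) * (P * (1 + 2 * β)) + (4 * q + 1) * (4 * q + 4) * (P * (1 + 2 * α))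
          ≡ (2 * P) * (1 + 2 * ((2 * q + 1) + (4 * q + 3) * β + (4 * q + 1) * (q + 1) * (1 + 2 * α)))
  factor₄ = solve-∀
  factor₅ : ∀ q P α β → (4 * q + 3) * (4 * q + 6) * (P * (1 + 2 * β)) + 2 * (4 * q + 1) * (4 * q + 4) * (P * (1 + 2 * α))
          ≡ (2 * P) * (1 + 2 * ((4 * q * q + 9 * q + 4) + (4 * q + 3) * (2 * q + 3) * β + (4 * q + 1) * (2 * q + 2) * (1 + 2 * α)))
  factor₅ = solve-∀
  T[4q+4]≡ : telephone (4 * suc q) ≡ 2 ^ suc q * suc (2 * α′)
  T[4q+4]≡ = begin
    telephone (4 * suc q)                                           ≡⟨ cong telephone (*-suc 4 q) ⟩
    telephone (4 + n)                                               ≡⟨ telephone[4+n] n ⟩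
    2 * (n + 3) * telephone (1 + n) + (n + 1) * (n + 4) * telephone n
      ≡⟨ cong₂ (λ u v → 2 * (n + 3) * u + (n + 1) * (n + 4) * v) T[1+4q]≡ T[4q]≡ ⟩
    2 * (n + 3) * (P * (1 + 2 * β)) + (n + 1) * (n + 4) * (P * (1 + 2 * α))  ≡⟨ factor₄ q P α β ⟩
    2 ^ suc q * suc (2 * α′)                                        ∎
    where open ≡-Reasoning
  T[4q+5]≡ : telephone (suc (4 * suc q)) ≡ 2 ^ suc q * suc (2 * β′)
  T[4q+5]≡ = begin
    telephone (suc (4 * suc q))                                     ≡⟨ cong (telephone ∘ suc) (*-suc 4 q) ⟩
    telephone (5 + n)                                               ≡⟨ telephone[5+n] n ⟩
    (n + 3) * (n + 6) * telephone (1 + n) + 2 * (n + 1) * (n + 4) * telephone n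
      ≡⟨ cong₂ (λ u v → (n + 3) * (n + 6) * u + 2 * (n + 1) * (n + 4) * v) T[1+4q]≡ T[4q]≡ ⟩
    (n + 3) * (n + 6) * (P * (1 + 2 * β)) + 2 * (n + 1) * (n + 4) * (P * (1 + 2 * α))  ≡⟨ factor₅ q P α β ⟩
    2 ^ suc q * suc (2 * β′)                                        ∎
    where open ≡-Reasoning

2^[1+q]∣telephone[2+4q] : ∀ q → 2 ^ suc q ∣ telephone (2 + 4 * q)
2^[1+q]∣telephone[2+4q] q with telephone-valuation q
... | (α , T[4q]≡) , (β , T[1+4q]≡) = divides (1 + β + 2 * q + (4 * q + 1) * α) (begin
  telephone (suc (4 * q)) + (1 + 4 * q) * telephone (4 * q)  ≡⟨ cong₂ (λ u v → u + (1 + 4 * q) * v) T[1+4q]≡ T[4q]≡ ⟩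
  P * (1 + 2 * β) + (1 + 4 * q) * (P * (1 + 2 * α))          ≡⟨ factor q P α β ⟩
  (1 + β + 2 * q + (4 * q + 1) * α) * (2 * P)                 ∎)
  where
  open ≡-Reasoning
  P = 2 ^ q
  factor : ∀ q P α β → P * (1 + 2 * β) + (1 + 4 * q) * (P * (1 + 2 * α)) ≡ (1 + β + 2 * q + (4 * q + 1) * α) * (2 * P)
  factor = solve-∀

2^[1+q]∣telephone[3+4q] : ∀ q → 2 ^ suc q ∣ telephone (3 + 4 * q)
2^[1+q]∣telephone[3+4q] q = ∣m∣n⇒∣m+n (2^[1+q]∣telephone[2+4q] q)
  (*-pres-∣ 2∣2+4q (twoAdicValuation⇒2^∣ {q = q} (proj₂ (telephone-valuation q))))
  where
  2∣2+4q : 2 ∣ 2 + 4 * q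
  2∣2+4q = ∣m∣n⇒∣m+n ∣-refl (∣m⇒∣m*n q (divides 2 refl))

∣-telephone-consecutive⇒∣-telephone : ∀ {d n m} → d ∣ telephone n → d ∣ telephone (suc n) → n ≤ m → d ∣ telephone m
∣-telephone-consecutive⇒∣-telephone {d} {n} {m} d∣Tn d∣T[1+n] n≤m =
  subst (λ k → d ∣ telephone k) (m∸n+n≡m n≤m) (proj₁ (from (m ∸ n)))
  where
  from : ∀ j → d ∣ telephone (j + n) × d ∣ telephone (suc (j + n))
  from zero = d∣Tn , d∣T[1+n]
  from (suc j) = let (d∣T[j+n] , d∣T[1+j+n]) = from j
                 in d∣T[1+j+n] , ∣m∣n⇒∣m+n d∣T[1+j+n] (∣n⇒∣m*n (suc (j + n)) d∣T[j+n])

2^[1+q]∣telephone : ∀ {q n} → 2 + 4 * q ≤ n → 2 ^ suc q ∣ telephone n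
2^[1+q]∣telephone {q} = ∣-telephone-consecutive⇒∣-telephone (2^[1+q]∣telephone[2+4q] q) (2^[1+q]∣telephone[3+4q] q)

2^[1+q]∤telephone[1+4q] : ∀ q → ¬ 2 ^ suc q ∣ telephone (suc (4 * q))
2^[1+q]∤telephone[1+4q] q = twoAdicValuation⇒2^[1+q]∤ {q = q} (proj₂ (telephone-valuation q))

-- Periods of the telephone numbers

telephone-periodicFrom : ∀ {ℓ} q → ¬ 2 ∣ ℓ → PeriodicFrom (2 ^ suc q * ℓ) telephone (2 + 4 * q) ℓ
telephone-periodicFrom {ℓ} q ¬2∣ℓ n N≤n = coprime⇒congruent-*
  (Coprimality.sym (coprime-^ (odd⇒coprime-2 ¬2∣ℓ) (suc q)))
  (congruent-trans (∣⇒congruent-0 (2^[1+q]∣telephone {q} (≤-trans N≤n (m≤m+n n ℓ))))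
                   (congruent-sym (∣⇒congruent-0 (2^[1+q]∣telephone {q} N≤n))))
  (odd⇒telephone[n+ℓ]≡telephone[n] ¬2∣ℓ n)

telephone-not-periodicFrom-below : ∀ {N d} q → N < 2 + 4 * q → 1 ≤ d → ¬ PeriodicFrom (2 ^ suc q) telephone N d
telephone-not-periodicFrom-below {N} {d} q N<2+4q 1≤d periodic = 2^[1+q]∤telephone[1+4q] q (congruent-0⇒∣ (begin
  telephone n₀                          ≈⟨ periodicFrom-iterate {f = telephone} periodic (2 + 4 * q) n₀ (s≤s⁻¹ N<2+4q) ⟨
  telephone (n₀ + (2 + 4 * q) * d)      ≈⟨ ∣⇒congruent-0 (2^[1+q]∣telephone {q} 2+4q≤n₀+[2+4q]d) ⟩
  0                                     ∎))
  where
  open import Relation.Binary.Reasoning.Setoid (congruent-setoid (2 ^ suc q))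
  n₀ = suc (4 * q)
  2+4q≤n₀+[2+4q]d : 2 + 4 * q ≤ n₀ + (2 + 4 * q) * d
  2+4q≤n₀+[2+4q]d = ≤-trans (m≤m*n (2 + 4 * q) d {{>-nonZero 1≤d}}) (m≤n+m _ n₀)

periodicFrom⇒m∣d*telephone : ∀ {m N d} → PeriodicFrom m telephone N d → ∀ n → N ≤ n → m ∣ d * telephone n
periodicFrom⇒m∣d*telephone {m} {N} {d} periodic n N≤n = congruent-0⇒∣ (+-cancelˡ-congruent (telephone (2 + n)) (begin
  telephone (2 + n) + d * telephone n               ≡⟨ regroup (telephone (suc n)) (telephone n) d n ⟩
  telephone (suc n) + (suc n + d) * telephone n     ≈⟨ +-congruent (periodic (suc n) (≤-trans N≤n (n≤1+n n))) (*-congruent (congruent-refl {a = suc n + d}) (periodic n N≤n)) ⟨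
  telephone (2 + n + d)                             ≈⟨ periodic (2 + n) (≤-trans N≤n (m≤n+m n 2)) ⟩
  telephone (2 + n)                                 ≡⟨ +-identityʳ _ ⟨
  telephone (2 + n) + 0                             ∎))
  where
  open import Relation.Binary.Reasoning.Setoid (congruent-setoid m)
  regroup : ∀ a b d n → (a + suc n * b) + d * b ≡ a + (suc n + d) * b
  regroup = solve-∀

odd∣telephone-eventually⇒≡1 : ∀ {a N} → ¬ 2 ∣ a → (∀ n → N ≤ n → a ∣ telephone n) → a ≡ 1
odd∣telephone-eventually⇒≡1 {zero} ¬2∣0 _ = contradiction (2 ∣0) ¬2∣0
odd∣telephone-eventually⇒≡1 {a@(suc _)} {N} ¬2∣a a∣telephone = ∣1⇒≡1 (congruent-0⇒∣ (begin
  1                        ≈⟨ periodicFrom-iterate (λ n _ → odd⇒telephone[n+ℓ]≡telephone[n] ¬2∣a n) N 0 z≤n ⟨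
  telephone (N * a)        ≈⟨ ∣⇒congruent-0 (a∣telephone (N * a) (m≤m*n N a)) ⟩
  0                        ∎))
  where open import Relation.Binary.Reasoning.Setoid (congruent-setoid a)

periodicFrom-odd⇒ℓ∣d : ∀ {ℓ N d} → ¬ 2 ∣ ℓ → PeriodicFrom ℓ telephone N d → ℓ ∣ d
periodicFrom-odd⇒ℓ∣d {zero} ¬2∣0 _ = contradiction (2 ∣0) ¬2∣0
periodicFrom-odd⇒ℓ∣d {ℓ@(suc _)} {N} {d} ¬2∣ℓ periodic = subst (_∣ d) g≡ℓ (gcd[m,n]∣n ℓ d)
  where
  g = gcd ℓ d
  instance
    g≢0 : NonZero g
    g≢0 = ≢-nonZero (gcd[m,n]≢0 ℓ d (inj₁ λ ()))
  ℓ/g≡1 : ℓ / g ≡ 1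
  ℓ/g≡1 = odd∣telephone-eventually⇒≡1 {N = N} (λ 2∣ℓ/g → ¬2∣ℓ (∣-trans 2∣ℓ/g (m/n∣m (gcd[m,n]∣m ℓ d))))
    (λ n N≤n → ∣-*⇒/gcd∣ {ℓ} {d} (periodicFrom⇒m∣d*telephone periodic n N≤n))
  g≡ℓ : g ≡ ℓ
  g≡ℓ = trans (sym (*-identityˡ g)) (trans (cong (_* g) (sym ℓ/g≡1)) (m/n*n≡m (gcd[m,n]∣m ℓ d)))

≡[mod]⇒periodicFrom : ∀ {m N d} → (∀ n → N ≤ n → t (n + d) ≡ t n [mod m ]) → PeriodicFrom m telephone N d
≡[mod]⇒periodicFrom {m} {d = d} periodic n N≤n =
  ≡[mod]⇒congruent (subst₂ (λ a b → a ≡ b [mod m ]) (t≡telephone (n + d)) (t≡telephone n) (periodic n N≤n))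

periodicFrom⇒≡[mod] : ∀ {m N d} → PeriodicFrom m telephone N d → (∀ n → N ≤ n → t (n + d) ≡ t n [mod m ])
periodicFrom⇒≡[mod] {m} {d = d} periodic n N≤n =
  subst₂ (λ a b → a ≡ b [mod m ]) (sym (t≡telephone (n + d))) (sym (t≡telephone n)) (congruent⇒≡[mod] (periodic n N≤n))

4*[1+q]∸2≡2+4*q : ∀ q → 4 * suc q ∸ 2 ≡ 2 + 4 * q
4*[1+q]∸2≡2+4*q q = cong (_∸ 2) (*-suc 4 q)

theorem6p3 : (ℓ k : ℕ) → ¬ (2 ∣ ℓ) → 1 ≤ k →
    let m = 2 ^ k * ℓ
        PeriodicFrom : ℕ → ℕ → Set
        PeriodicFrom N d = ∀ n → N ≤ n → t (n + d) ≡ t n [mod m ]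
        N = 4 * k ∸ 2
    in (∃[ d ] (1 ≤ d × PeriodicFrom N d))
       × (∀ N′ → N′ < N → ¬ (∃[ d ] (1 ≤ d × PeriodicFrom N′ d)))
       × PeriodicFrom N ℓ
       × (∀ d → 1 ≤ d → d < ℓ → ¬ PeriodicFrom N d)
theorem6p3 zero _ ¬2∣0 _ = contradiction (2 ∣0) ¬2∣0
theorem6p3 ℓ@(suc _) (suc q) ¬2∣ℓ _ rewrite 4*[1+q]∸2≡2+4*q q =
    (ℓ , s≤s z≤n , periodic)
  , (λ N N<2+4q (d , 1≤d , p) → telephone-not-periodicFrom-below q N<2+4q 1≤d
                                  (periodicFrom-∣ (m∣m*n ℓ) (≡[mod]⇒periodicFrom p)))
  , periodic
  , (λ d 1≤d d<ℓ p → <⇒≱ d<ℓ (∣⇒≤ {{>-nonZero 1≤d}}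
                      (periodicFrom-odd⇒ℓ∣d ¬2∣ℓ (periodicFrom-∣ (n∣m*n (2 ^ suc q)) (≡[mod]⇒periodicFrom p)))))
  where
  periodic = periodicFrom⇒≡[mod] (telephone-periodicFrom q ¬2∣ℓ)
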